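{- Let $1\le h\le m$ and $g\ge0$ be integers. The number of compositions $(a_1,\dots,a_h)$ of $m$ into $h$ positive parts with $\sum_{i=1}^h\max(a_i-2,0)=g$ (equivalently, whose deletion of the first two columns has weight $g$) equals $c'^{\,mg}_{h}$, where $$c'^{\,mg}_{h}=\frac1g\sum_{\ell=0}^{\min(h,g,m-h-g)}\ell\binom{h}{\ell}\binom{g}{\ell}\binom{h-\ell}{m-g-h-\ell}\quad(g\ne0),\qquad c'^{\,m0}_{h}=\binom{h}{m-h}$$ (the latter being $0$ if $m>2h$).
   Context: A composition of weight $m$ and dimension $h$ is an ordered $h$-tuple of positive integers summing to $m$. Deleting the first two columns of $(a_1,\dots,a_h)$ yields $(a_i-2)_{i:\,a_i\ge3}$, a composition of weight $\sum_i\max(a_i-2,0)$. Binomial coefficients $\binom ab$ are $0$ unless $0\le b\le a$. -}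

module Defs where

open import Data.Nat using (ℕ; zero; suc; _+_; _*_; _∸_; _≤_; _<ᵇ_; _⊔_; _⊓_)
open import Data.Nat.Combinatorics using (_C_)
open import Data.Bool using (Bool; true; false; if_then_else_)
open import Data.List using (List; []; _∷_; map; concatMap; filter; length; upTo)
open import Data.Nat.ListAction using (sum)
open import Data.Vec using (Vec; []; _∷_; foldr)
open import Relation.Binary.PropositionalEquality using (_≡_)
open import Relation.Nullary using (Dec)
open import Data.Nat using (_≟_)

compositions : (m h : ℕ) → List (Vec ℕ h)
compositions zero    zero    = [] ∷ []
compositions (suc m) zero    = []
compositions m       (suc h) =
  concatMap (λ a → map (λ v → suc a ∷ v) (compositions (m ∸ suc a) h))
            (filter (λ a → suc a Data.Nat.≤? m) (upTo m))

delWeight : ∀ {h} → Vec ℕ h → ℕ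
delWeight = foldr _ (λ a s → (a ∸ 2) + s) 0

countComp : (m h g : ℕ) → ℕ
countComp m h g = length (filter (λ v → delWeight v ≟ g) (compositions m h))

-- Binomial coefficient with integer lower index b = (p - q):
-- binom a p q = (a choose (p - q)) if q ≤ p, and 0 if p - q < 0.
binomDiff : (a p q : ℕ) → ℕ
binomDiff a p q = if p <ᵇ q then 0 else a C (p ∸ q)

cSum : (m h g : ℕ) → ℕ
cSum m h g =
  if m <ᵇ h + g then 0
  else sum (map (λ ℓ → ℓ * (h C ℓ) * (g C ℓ) * binomDiff (h ∸ ℓ) m (g + h + ℓ))
                (upTo (suc (h ⊓ g ⊓ (m ∸ (h + g))))))

{-# OPTIONS --safe #-}
-- With t = m − h − g, a composition counted by countComp m h g is obtained by choosing which t
-- of its h parts are at least 2 (the others equal 1) and distributing the excess g over those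
-- t parts: C(h,t) · multichoose t g ways. Splitting off the first part proves this by induction
-- on h. On the other side, C(h,ℓ) C(h−ℓ,t−ℓ) = C(h,t) C(t,ℓ) pulls C(h,t) out of the sum, and
-- ℓ C(g,ℓ) = g C(g−1,ℓ−1) followed by Vandermonde sums the rest to g · multichoose t g.
module Submission where

open import Defs
open import Data.Nat using (ℕ; zero; suc; _≤_; _/_; _∸_)
open import Data.Nat.Combinatorics using (_C_)
open import Relation.Binary.PropositionalEquality using (_≡_)
open import Data.Product using (_×_)

open import Data.Bool using (true; false; if_then_else_)
open import Data.List using (List; []; _∷_; map; concatMap; filter; length; upTo; applyUpTo)
open import Data.List.Properties
  using (filter-++; length-++; filter-all; filter-none; filter-≐; map-upTo; map-cong)
open import Data.List.Relation.Unary.All using (universal)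
open import Data.List.Relation.Unary.All.Properties using (applyUpTo⁺₁)
open import Data.Nat using (_+_; _*_; _<_; _⊓_; _<ᵇ_; _!; _≟_; _≤?_; _<?_; z≤n; s≤s; z<s; s<s; NonZero)
open import Data.Nat.Combinatorics
  using (nCk≡n!/k![n-k]!; k![n∸k]!∣n!; k>n⇒nCk≡0; nCk≡nC[n∸k]; nCk+nC[k+1]≡[n+1]C[k+1])
open import Data.Nat.DivMod using (m/n*n≡m; m*n/n≡m)
open import Data.Nat.ListAction using (sum)
open import Data.Nat.Properties
open import Data.Nat.Tactic.RingSolver using (solve-∀)
open import Data.Product using (_,_)
open import Data.Vec using (Vec; _∷_)
open import Function using (_∘_; id)
open import Level using (Level)
open import Relation.Binary.PropositionalEquality
  using (_≢_; refl; sym; trans; cong; cong₂; subst; module ≡-Reasoning)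
open import Relation.Nullary using (Dec; yes; no; does; contradiction)
open import Relation.Nullary.Reflects using (ofʸ; ofⁿ)
open import Relation.Unary using (Pred; Decidable)

∑ : ℕ → (ℕ → ℕ) → ℕ
∑ zero    f = 0
∑ (suc n) f = f 0 + ∑ n (f ∘ suc)

infix 5 ∑
syntax ∑ n (λ i → e) = ∑[ i < n ] e

sum-applyUpTo : ∀ n (f : ℕ → ℕ) → sum (applyUpTo f n) ≡ ∑ n f
sum-applyUpTo zero    f = refl
sum-applyUpTo (suc n) f = cong (f 0 +_) (sum-applyUpTo n (f ∘ suc))

sum-map-upTo : ∀ n (f : ℕ → ℕ) → sum (map f (upTo n)) ≡ ∑ n f
sum-map-upTo n f = trans (cong sum (map-upTo f n)) (sum-applyUpTo n f)

∑-cong : ∀ n {f g : ℕ → ℕ} → (∀ {i} → i < n → f i ≡ g i) → ∑ n f ≡ ∑ n g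
∑-cong zero    f≡g = refl
∑-cong (suc n) f≡g = cong₂ _+_ (f≡g z<s) (∑-cong n (λ i<n → f≡g (s<s i<n)))

∑-zero : ∀ n {f : ℕ → ℕ} → (∀ {i} → i < n → f i ≡ 0) → ∑ n f ≡ 0
∑-zero zero    f≡0 = refl
∑-zero (suc n) f≡0 = cong₂ _+_ (f≡0 z<s) (∑-zero n (λ i<n → f≡0 (s<s i<n)))

∑-truncate : ∀ {m n} {f : ℕ → ℕ} → m ≤ n → (∀ {i} → m ≤ i → f i ≡ 0) → ∑ n f ≡ ∑ m f
∑-truncate {zero}  {n}     _         f≡0 = ∑-zero n (λ _ → f≡0 z≤n)
∑-truncate {suc m} {suc n} {f} (s≤s m≤n) f≡0 =
  cong (f 0 +_) (∑-truncate m≤n (λ m≤i → f≡0 (s≤s m≤i)))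

∑-*ˡ : ∀ n c (f : ℕ → ℕ) → (∑[ i < n ] c * f i) ≡ c * ∑ n f
∑-*ˡ zero    c f = sym (*-zeroʳ c)
∑-*ˡ (suc n) c f =
  trans (cong (c * f 0 +_) (∑-*ˡ n c (f ∘ suc))) (sym (*-distribˡ-+ c (f 0) _))

∑-+ : ∀ n (f g : ℕ → ℕ) → (∑[ i < n ] f i + g i) ≡ ∑ n f + ∑ n g
∑-+ zero    f g = refl
∑-+ (suc n) f g =
  trans (cong (f 0 + g 0 +_) (∑-+ n (f ∘ suc) (g ∘ suc))) (interchange (f 0) (g 0) _ _)
  where
  interchange : ∀ a b c d → a + b + (c + d) ≡ a + c + (b + d)
  interchange = solve-∀

module _ {a b p : Level} {A : Set a} {B : Set b} {P : Pred B p} (P? : Decidable P) where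

  length-filter-map : ∀ (f : A → B) xs → length (filter P? (map f xs)) ≡ length (filter (P? ∘ f) xs)
  length-filter-map f []       = refl
  length-filter-map f (x ∷ xs) with does (P? (f x))
  ... | true  = cong suc (length-filter-map f xs)
  ... | false = length-filter-map f xs

  length-filter-concatMap : ∀ (F : A → List B) xs →
    length (filter P? (concatMap F xs)) ≡ sum (map (length ∘ filter P? ∘ F) xs)
  length-filter-concatMap F []       = refl
  length-filter-concatMap F (x ∷ xs) =
    trans (cong length (filter-++ P? (F x) (concatMap F xs)))
          (trans (length-++ (filter P? (F x)))
                 (cong (length (filter P? (F x)) +_) (length-filter-concatMap F xs)))

vandermonde : ∀ a b n → (∑[ k < suc n ] (a C k) * (b C (n ∸ k))) ≡ (a + b) C n
vandermonde zero    b n       =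
  trans (cong₂ _+_ (*-identityˡ (b C n)) (∑-zero n (λ _ → refl))) (+-identityʳ (b C n))
vandermonde (suc a) b zero    = refl
-- Pascal's rule on the first factor splits the sum into the instance for n and, together with
-- the k = 0 term H, the instance for suc n.
vandermonde (suc a) b (suc n) = begin
  H + (∑[ k < suc n ] (suc a C suc k) * (b C (n ∸ k)))
    ≡⟨ cong (H +_) (trans (∑-cong (suc n) (λ {k} _ → pascal k))
                          (∑-+ (suc n) (λ k → (a C k) * (b C (n ∸ k))) (λ k → (a C suc k) * (b C (n ∸ k))))) ⟩
  H + ((∑[ k < suc n ] (a C k) * (b C (n ∸ k))) + X)
    ≡⟨ cong (λ v → H + (v + X)) (vandermonde a b n) ⟩
  H + ((a + b) C n + X)
    ≡⟨ +-comm-assoc H ((a + b) C n) X ⟩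
  (a + b) C n + (H + X)
    ≡⟨ cong ((a + b) C n +_) (vandermonde a b (suc n)) ⟩
  (a + b) C n + (a + b) C suc n
    ≡⟨ nCk+nC[k+1]≡[n+1]C[k+1] (a + b) n ⟩
  suc (a + b) C suc n ∎
  where
  open ≡-Reasoning
  H X : ℕ
  H = (a C 0) * (b C suc n)
  X = ∑[ k < suc n ] (a C suc k) * (b C (n ∸ k))
  pascal : ∀ k → (suc a C suc k) * (b C (n ∸ k)) ≡ (a C k) * (b C (n ∸ k)) + (a C suc k) * (b C (n ∸ k))
  pascal k = trans (cong (_* (b C (n ∸ k))) (sym (nCk+nC[k+1]≡[n+1]C[k+1] a k)))
                   (*-distribʳ-+ (b C (n ∸ k)) (a C k) (a C suc k))
  +-comm-assoc : ∀ x y z → x + (y + z) ≡ y + (x + z)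
  +-comm-assoc = solve-∀

nCk*k![n∸k]!≡n! : ∀ {n k} → k ≤ n → (n C k) * (k ! * (n ∸ k) !) ≡ n !
nCk*k![n∸k]!≡n! {n} {k} k≤n = trans (cong (_* (k ! * (n ∸ k) !)) (nCk≡n!/k![n-k]! k≤n))
                                    (m/n*n≡m {{k !* (n ∸ k) !≢0}} (k![n∸k]!∣n! k≤n))

[k+1]*[n+1]C[k+1]≡[n+1]*nCk : ∀ n k → suc k * (suc n C suc k) ≡ suc n * (n C k)
[k+1]*[n+1]C[k+1]≡[n+1]*nCk n k with k ≤? n
... | no k≰n = begin
  suc k * (suc n C suc k) ≡⟨ cong (suc k *_) (k>n⇒nCk≡0 (s<s (≰⇒> k≰n))) ⟩
  suc k * 0               ≡⟨ *-zeroʳ (suc k) ⟩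
  0                       ≡⟨ *-zeroʳ (suc n) ⟨
  suc n * 0               ≡⟨ cong (suc n *_) (k>n⇒nCk≡0 (≰⇒> k≰n)) ⟨
  suc n * (n C k)         ∎
  where open ≡-Reasoning
... | yes k≤n = *-cancelʳ-≡ _ _ (k ! * (n ∸ k) !) {{k !* (n ∸ k) !≢0}} (begin
  suc k * (suc n C suc k) * (k ! * (n ∸ k) !) ≡⟨ regroup (suc k) (suc n C suc k) (k !) ((n ∸ k) !) ⟩
  (suc n C suc k) * (suc k ! * (n ∸ k) !)     ≡⟨ nCk*k![n∸k]!≡n! (s≤s k≤n) ⟩
  suc n !                                     ≡⟨ cong (suc n *_) (nCk*k![n∸k]!≡n! k≤n) ⟨
  suc n * ((n C k) * (k ! * (n ∸ k) !))       ≡⟨ *-assoc (suc n) (n C k) _ ⟨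
  suc n * (n C k) * (k ! * (n ∸ k) !)         ∎)
  where
  open ≡-Reasoning
  regroup : ∀ a c x y → a * c * (x * y) ≡ c * (a * x * y)
  regroup = solve-∀

nCk*[n∸k]C[m∸k]≡nCm*mCk : ∀ n {m k} → k ≤ m → (n C k) * ((n ∸ k) C (m ∸ k)) ≡ (n C m) * (m C k)
nCk*[n∸k]C[m∸k]≡nCm*mCk n {m} {k} k≤m with m ≤? n
... | no m≰n = trans lhs≡0 (sym (cong (_* (m C k)) (k>n⇒nCk≡0 (≰⇒> m≰n))))
  where
  lhs≡0 : (n C k) * ((n ∸ k) C (m ∸ k)) ≡ 0
  lhs≡0 with k ≤? n
  ... | yes k≤n = trans (cong ((n C k) *_) (k>n⇒nCk≡0 (∸-monoˡ-< (≰⇒> m≰n) k≤n))) (*-zeroʳ (n C k))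
  ... | no k≰n  = cong (_* ((n ∸ k) C (m ∸ k))) (k>n⇒nCk≡0 (≰⇒> k≰n))
... | yes m≤n = *-cancelʳ-≡ _ _ D {{D≢0}} (trans lhs≡n! (sym rhs≡n!))
  where
  open ≡-Reasoning
  D : ℕ
  D = k ! * ((m ∸ k) ! * (n ∸ m) !)
  D≢0 : NonZero D
  D≢0 = m*n≢0 (k !) _ {{k !≢0}} {{(m ∸ k) !* (n ∸ m) !≢0}}
  lhs≡n! : (n C k) * ((n ∸ k) C (m ∸ k)) * D ≡ n !
  lhs≡n! = begin
    (n C k) * ((n ∸ k) C (m ∸ k)) * D
      ≡⟨ regroupˡ (n C k) ((n ∸ k) C (m ∸ k)) (k !) ((m ∸ k) !) ((n ∸ m) !) ⟩
    (n C k) * (k ! * (((n ∸ k) C (m ∸ k)) * ((m ∸ k) ! * (n ∸ m) !)))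
      ≡⟨ cong (λ r → (n C k) * (k ! * (((n ∸ k) C (m ∸ k)) * ((m ∸ k) ! * r !)))) n∸k∸[m∸k]≡n∸m ⟨
    (n C k) * (k ! * (((n ∸ k) C (m ∸ k)) * ((m ∸ k) ! * (n ∸ k ∸ (m ∸ k)) !)))
      ≡⟨ cong (λ r → (n C k) * (k ! * r)) (nCk*k![n∸k]!≡n! (∸-monoˡ-≤ k m≤n)) ⟩
    (n C k) * (k ! * (n ∸ k) !)
      ≡⟨ nCk*k![n∸k]!≡n! (≤-trans k≤m m≤n) ⟩
    n ! ∎
    where
    n∸k∸[m∸k]≡n∸m : n ∸ k ∸ (m ∸ k) ≡ n ∸ m
    n∸k∸[m∸k]≡n∸m = trans (∸-+-assoc n k (m ∸ k)) (cong (n ∸_) (m+[n∸m]≡n k≤m))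
    regroupˡ : ∀ a b x y z → a * b * (x * (y * z)) ≡ a * (x * (b * (y * z)))
    regroupˡ = solve-∀
  rhs≡n! : (n C m) * (m C k) * D ≡ n !
  rhs≡n! = begin
    (n C m) * (m C k) * D
      ≡⟨ regroupʳ (n C m) (m C k) (k !) ((m ∸ k) !) ((n ∸ m) !) ⟩
    (n C m) * ((m C k) * (k ! * (m ∸ k) !) * (n ∸ m) !)
      ≡⟨ cong (λ r → (n C m) * (r * (n ∸ m) !)) (nCk*k![n∸k]!≡n! k≤m) ⟩
    (n C m) * (m ! * (n ∸ m) !)
      ≡⟨ nCk*k![n∸k]!≡n! m≤n ⟩
    n ! ∎
    where
    regroupʳ : ∀ a b x y z → a * b * (x * (y * z)) ≡ a * (b * (x * y) * z)
    regroupʳ = solve-∀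

multichoose : ℕ → ℕ → ℕ
multichoose _       zero    = 1
multichoose zero    (suc k) = 0
multichoose (suc n) (suc k) = multichoose n (suc k) + multichoose (suc n) k

multichoose-hockey : ∀ t g → (∑[ b < suc g ] multichoose t (g ∸ b)) ≡ multichoose (suc t) g
multichoose-hockey t zero    = refl
multichoose-hockey t (suc g) = cong (multichoose t (suc g) +_) (multichoose-hockey t g)

multichoose-suc : ∀ t g → multichoose t (suc g) ≡ (t + g) C suc g
multichoose-suc zero    g       = sym (k>n⇒nCk≡0 (n<1+n g))
multichoose-suc (suc t) zero    =
  trans (cong (_+ 1) (multichoose-suc t 0))
        (trans (+-comm _ 1) (nCk+nC[k+1]≡[n+1]C[k+1] (t + 0) 0))
multichoose-suc (suc t) (suc g) =
  trans (cong₂ _+_ (multichoose-suc t (suc g))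
                   (trans (multichoose-suc (suc t) g) (cong (_C suc g) (sym (+-suc t g)))))
        (trans (+-comm ((t + suc g) C suc (suc g)) _) (nCk+nC[k+1]≡[n+1]C[k+1] (t + suc g) (suc g)))

shifted-vandermonde : ∀ g t → (∑[ k < t ] (g C k) * (t C suc k)) ≡ (t + g) C suc g
shifted-vandermonde g t = begin
  ∑ t f
    ≡⟨ ∑-truncate (m≤m+n t (suc g)) (λ {k} t≤k →
         trans (cong ((g C k) *_) (k>n⇒nCk≡0 (s≤s t≤k))) (*-zeroʳ (g C k))) ⟨
  ∑ (t + suc g) f
    ≡⟨ ∑-truncate (m≤n+m (suc g) t) (λ {k} g<k → cong (_* (t C suc k)) (k>n⇒nCk≡0 g<k)) ⟩
  ∑ (suc g) f
    ≡⟨ ∑-cong (suc g) (λ k<1+g → symmetric (≤-pred k<1+g)) ⟩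
  (∑[ k < suc g ] (t C suc k) * (g C (g ∸ k)))
    ≡⟨ cong (_+ (∑[ k < suc g ] (t C suc k) * (g C (g ∸ k)))) head≡0 ⟨
  (∑[ k < suc (suc g) ] (t C k) * (g C (suc g ∸ k)))
    ≡⟨ vandermonde t g (suc g) ⟩
  (t + g) C suc g ∎
  where
  open ≡-Reasoning
  f : ℕ → ℕ
  f k = (g C k) * (t C suc k)
  symmetric : ∀ {k} → k ≤ g → f k ≡ (t C suc k) * (g C (g ∸ k))
  symmetric {k} k≤g = trans (*-comm (g C k) _) (cong ((t C suc k) *_) (nCk≡nC[n∸k] k≤g))
  head≡0 : (t C 0) * (g C suc g) ≡ 0
  head≡0 = trans (*-identityˡ (g C suc g)) (k>n⇒nCk≡0 (n<1+n g))

weighted-vandermonde : ∀ g t →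
  (∑[ ℓ < suc t ] ℓ * (suc g C ℓ) * (t C ℓ)) ≡ suc g * multichoose t (suc g)
weighted-vandermonde g t = begin
  (∑[ k < t ] suc k * (suc g C suc k) * (t C suc k))
    ≡⟨ ∑-cong t (λ {k} _ → absorb k) ⟩
  (∑[ k < t ] suc g * ((g C k) * (t C suc k)))
    ≡⟨ ∑-*ˡ t (suc g) (λ k → (g C k) * (t C suc k)) ⟩
  suc g * (∑[ k < t ] (g C k) * (t C suc k))
    ≡⟨ cong (suc g *_) (trans (shifted-vandermonde g t) (sym (multichoose-suc t g))) ⟩
  suc g * multichoose t (suc g) ∎
  where
  open ≡-Reasoning
  absorb : ∀ k → suc k * (suc g C suc k) * (t C suc k) ≡ suc g * ((g C k) * (t C suc k))
  absorb k = trans (cong (_* (t C suc k)) ([k+1]*[n+1]C[k+1]≡[n+1]*nCk g k))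
                   (*-assoc (suc g) (g C k) (t C suc k))

if-<ᵇ-< : ∀ {A : Set} {m n} {x y : A} → m < n → (if m <ᵇ n then x else y) ≡ x
if-<ᵇ-< {m = m} {n} m<n with m <ᵇ n | <ᵇ-reflects-< m n
... | true  | _        = refl
... | false | ofⁿ m≮n = contradiction m<n m≮n

if-<ᵇ-≥ : ∀ {A : Set} {m n} {x y : A} → n ≤ m → (if m <ᵇ n then x else y) ≡ y
if-<ᵇ-≥ {m = m} {n} n≤m with m <ᵇ n | <ᵇ-reflects-< m n
... | true  | ofʸ m<n = contradiction m<n (≤⇒≯ n≤m)
... | false | _       = refl

binomDiff-≥ : ∀ a {p q} → q ≤ p → binomDiff a p q ≡ a C (p ∸ q)
binomDiff-≥ a = if-<ᵇ-≥

binomDiff-< : ∀ a {p q} → p < q → binomDiff a p q ≡ 0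
binomDiff-< a = if-<ᵇ-<

binomDiff-+ : ∀ a n p q → binomDiff a (n + p) (n + q) ≡ binomDiff a p q
binomDiff-+ a zero    p q = refl
binomDiff-+ a (suc n) p q = binomDiff-+ a n p q

cSum-below : ∀ m h g → m < h + g → cSum m h g ≡ 0
cSum-below m h g = if-<ᵇ-<

cSum-closed : ∀ h g t → cSum (h + g + t) h g ≡ (h C t) * (∑[ ℓ < suc t ] ℓ * (g C ℓ) * (t C ℓ))
cSum-closed h g t = begin
  cSum m h g
    ≡⟨ if-<ᵇ-≥ (m≤m+n (h + g) t) ⟩
  sum (map term (upTo (suc (h ⊓ g ⊓ (m ∸ (h + g))))))
    ≡⟨ sum-map-upTo (suc (h ⊓ g ⊓ (m ∸ (h + g)))) term ⟩
  ∑ (suc (h ⊓ g ⊓ (m ∸ (h + g)))) term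
    ≡⟨ cong (λ r → ∑ (suc (h ⊓ g ⊓ r)) term) (m+n∸m≡n (h + g) t) ⟩
  ∑ (suc (h ⊓ g ⊓ t)) term
    ≡⟨ ∑-truncate (s≤s (m⊓n≤n (h ⊓ g) t)) term-vanishes ⟨
  ∑ (suc t) term
    ≡⟨ ∑-cong (suc t) (λ ℓ<1+t → term-closed (≤-pred ℓ<1+t)) ⟩
  (∑[ ℓ < suc t ] (h C t) * (ℓ * (g C ℓ) * (t C ℓ)))
    ≡⟨ ∑-*ˡ (suc t) (h C t) (λ ℓ → ℓ * (g C ℓ) * (t C ℓ)) ⟩
  (h C t) * (∑[ ℓ < suc t ] ℓ * (g C ℓ) * (t C ℓ)) ∎
  where
  open ≡-Reasoning
  m : ℕ
  m = h + g + t
  B : ℕ → ℕ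
  B ℓ = binomDiff (h ∸ ℓ) m (g + h + ℓ)
  term : ℕ → ℕ
  term ℓ = ℓ * (h C ℓ) * (g C ℓ) * B ℓ
  B≡binomDiff[t,ℓ] : ∀ ℓ → B ℓ ≡ binomDiff (h ∸ ℓ) t ℓ
  B≡binomDiff[t,ℓ] ℓ = trans (cong (λ s → binomDiff (h ∸ ℓ) m (s + ℓ)) (+-comm g h))
                             (binomDiff-+ (h ∸ ℓ) (h + g) t ℓ)
  term-vanishes : ∀ {ℓ} → h ⊓ g ⊓ t < ℓ → term ℓ ≡ 0
  term-vanishes {ℓ} min<ℓ with h <? ℓ | g <? ℓ | t <? ℓ
  ... | yes h<ℓ | _ | _ =
    trans (cong (λ c → ℓ * c * (g C ℓ) * B ℓ) (k>n⇒nCk≡0 h<ℓ))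
          (cong (λ z → z * (g C ℓ) * B ℓ) (*-zeroʳ ℓ))
  ... | no _ | yes g<ℓ | _ =
    trans (cong (λ c → ℓ * (h C ℓ) * c * B ℓ) (k>n⇒nCk≡0 g<ℓ))
          (cong (_* B ℓ) (*-zeroʳ (ℓ * (h C ℓ))))
  ... | no _ | no _ | yes t<ℓ =
    trans (cong (ℓ * (h C ℓ) * (g C ℓ) *_) (trans (B≡binomDiff[t,ℓ] ℓ) (binomDiff-< (h ∸ ℓ) t<ℓ)))
          (*-zeroʳ (ℓ * (h C ℓ) * (g C ℓ)))
  ... | no h≮ℓ | no g≮ℓ | no t≮ℓ =
    contradiction (⊓-glb (⊓-glb (≮⇒≥ h≮ℓ) (≮⇒≥ g≮ℓ)) (≮⇒≥ t≮ℓ)) (<⇒≱ min<ℓ)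
  term-closed : ∀ {ℓ} → ℓ ≤ t → term ℓ ≡ (h C t) * (ℓ * (g C ℓ) * (t C ℓ))
  term-closed {ℓ} ℓ≤t = begin
    ℓ * (h C ℓ) * (g C ℓ) * B ℓ
      ≡⟨ cong (ℓ * (h C ℓ) * (g C ℓ) *_) (trans (B≡binomDiff[t,ℓ] ℓ) (binomDiff-≥ (h ∸ ℓ) ℓ≤t)) ⟩
    ℓ * (h C ℓ) * (g C ℓ) * ((h ∸ ℓ) C (t ∸ ℓ))
      ≡⟨ regroupˡ ℓ (h C ℓ) (g C ℓ) ((h ∸ ℓ) C (t ∸ ℓ)) ⟩
    ℓ * (g C ℓ) * ((h C ℓ) * ((h ∸ ℓ) C (t ∸ ℓ)))
      ≡⟨ cong (ℓ * (g C ℓ) *_) (nCk*[n∸k]C[m∸k]≡nCm*mCk h ℓ≤t) ⟩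
    ℓ * (g C ℓ) * ((h C t) * (t C ℓ))
      ≡⟨ regroupʳ ℓ (g C ℓ) (h C t) (t C ℓ) ⟩
    (h C t) * (ℓ * (g C ℓ) * (t C ℓ)) ∎
    where
    regroupˡ : ∀ x a y b → x * a * y * b ≡ x * y * (a * b)
    regroupˡ = solve-∀
    regroupʳ : ∀ x y c z → x * y * (c * z) ≡ c * (x * y * z)
    regroupʳ = solve-∀

countShiftedWeight : ∀ {h} → ℕ → ℕ → List (Vec ℕ h) → ℕ
countShiftedWeight k g vs = length (filter (λ v → k + delWeight v ≟ g) vs)

countShiftedWeight-≤ : ∀ {h k g} (vs : List (Vec ℕ h)) → k ≤ g →
  countShiftedWeight k g vs ≡ countShiftedWeight 0 (g ∸ k) vs
countShiftedWeight-≤ {k = k} {g} vs k≤g =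
  cong length (filter-≐ (λ v → k + delWeight v ≟ g) (λ v → delWeight v ≟ g ∸ k) (to , from) vs)
  where
  to : ∀ {d} → k + d ≡ g → d ≡ g ∸ k
  to {d} k+d≡g = trans (sym (m+n∸m≡n k d)) (cong (_∸ k) k+d≡g)
  from : ∀ {d} → d ≡ g ∸ k → k + d ≡ g
  from d≡g∸k = trans (cong (k +_) d≡g∸k) (m+[n∸m]≡n k≤g)

countShiftedWeight-> : ∀ {h k g} (vs : List (Vec ℕ h)) → g < k → countShiftedWeight k g vs ≡ 0
countShiftedWeight-> {k = k} {g} vs g<k =
  cong length (filter-none (λ v → k + delWeight v ≟ g) (universal too-heavy vs))
  where
  too-heavy : ∀ v → k + delWeight v ≢ g
  too-heavy v k+d≡g = <⇒≱ g<k (subst (k ≤_) k+d≡g (m≤m+n k (delWeight v)))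

-- Counts the compositions of suc m into suc h parts of weight g whose first part, b + 2, is at least 2.
countFirst≥2 : ℕ → ℕ → ℕ → ℕ
countFirst≥2 m h g = ∑[ b < m ] countShiftedWeight b g (compositions (m ∸ suc b) h)

countComp-suc : ∀ m h g → countComp (suc m) (suc h) g ≡ countComp m h g + countFirst≥2 m h g
countComp-suc m h g = begin
  length (filter P? (concatMap F (filter (λ a → suc a ≤? suc m) (upTo (suc m)))))
    ≡⟨ cong (λ as → length (filter P? (concatMap F as)))
            (filter-all (λ a → suc a ≤? suc m) (applyUpTo⁺₁ id (suc m) id)) ⟩
  length (filter P? (concatMap F (upTo (suc m))))
    ≡⟨ length-filter-concatMap P? F (upTo (suc m)) ⟩
  sum (map (length ∘ filter P? ∘ F) (upTo (suc m)))
    ≡⟨ cong sum (map-cong (λ a → length-filter-map P? (suc a ∷_) (compositions (m ∸ a) h))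
                          (upTo (suc m))) ⟩
  sum (map first-part (upTo (suc m)))
    ≡⟨ sum-map-upTo (suc m) first-part ⟩
  countComp m h g + countFirst≥2 m h g ∎
  where
  open ≡-Reasoning
  P? : (v : Vec ℕ (suc h)) → Dec (delWeight v ≡ g)
  P? v = delWeight v ≟ g
  F : ℕ → List (Vec ℕ (suc h))
  F a = map (suc a ∷_) (compositions (m ∸ a) h)
  first-part : ℕ → ℕ
  first-part a = countShiftedWeight (suc a ∸ 2) g (compositions (m ∸ a) h)

countComp-vanishes : ∀ h m g → m < h + g → countComp m h g ≡ 0
countFirst≥2-vanishes : ∀ h m g → m ≤ h + g → countFirst≥2 m h g ≡ 0

countComp-vanishes zero    zero    (suc g) _ = refl
countComp-vanishes zero    (suc m) g       _ = refl
countComp-vanishes (suc h) zero    g       _ = refl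
countComp-vanishes (suc h) (suc m) g (s<s m<h+g) = begin
  countComp (suc m) (suc h) g          ≡⟨ countComp-suc m h g ⟩
  countComp m h g + countFirst≥2 m h g ≡⟨ cong₂ _+_ (countComp-vanishes h m g m<h+g)
                                                     (countFirst≥2-vanishes h m g (<⇒≤ m<h+g)) ⟩
  0                                    ∎
  where open ≡-Reasoning

countFirst≥2-vanishes h m g m≤h+g = ∑-zero m term-vanishes
  where
  term-vanishes : ∀ {b} → b < m → countShiftedWeight b g (compositions (m ∸ suc b) h) ≡ 0
  term-vanishes {b} b<m with b ≤? g
  ... | no b≰g  = countShiftedWeight-> (compositions (m ∸ suc b) h) (≰⇒> b≰g)
  ... | yes b≤g = trans (countShiftedWeight-≤ (compositions (m ∸ suc b) h) b≤g)
                        (countComp-vanishes h (m ∸ suc b) (g ∸ b) rest<h+[g∸b])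
    where
    open ≤-Reasoning
    rest<h+[g∸b] : m ∸ suc b < h + (g ∸ b)
    rest<h+[g∸b] = begin-strict
      m ∸ suc b   <⟨ ∸-monoʳ-< (n<1+n b) b<m ⟩
      m ∸ b       ≤⟨ ∸-monoˡ-≤ b m≤h+g ⟩
      h + g ∸ b   ≡⟨ +-∸-assoc h b≤g ⟩
      h + (g ∸ b) ∎

countComp-closed : ∀ h g t → countComp (h + g + t) h g ≡ (h C t) * multichoose t g
countFirst≥2-closed : ∀ h g t → countFirst≥2 (h + g + suc t) h g ≡ (h C t) * multichoose (suc t) g

countComp-closed zero    zero    zero    = refl
countComp-closed zero    zero    (suc t) = refl
countComp-closed zero    (suc g) zero    = refl
countComp-closed zero    (suc g) (suc t) = refl
countComp-closed (suc h) g       zero    = begin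
  countComp (suc (h + g + 0)) (suc h) g
    ≡⟨ countComp-suc (h + g + 0) h g ⟩
  countComp (h + g + 0) h g + countFirst≥2 (h + g + 0) h g
    ≡⟨ cong₂ _+_ (countComp-closed h g 0)
                 (countFirst≥2-vanishes h (h + g + 0) g (≤-reflexive (+-identityʳ (h + g)))) ⟩
  (h C 0) * multichoose 0 g + 0
    ≡⟨ +-identityʳ _ ⟩
  (suc h C 0) * multichoose 0 g ∎
  where open ≡-Reasoning
countComp-closed (suc h) g       (suc t) = begin
  countComp (suc (h + g + suc t)) (suc h) g
    ≡⟨ countComp-suc (h + g + suc t) h g ⟩
  countComp (h + g + suc t) h g + countFirst≥2 (h + g + suc t) h g
    ≡⟨ cong₂ _+_ (countComp-closed h g (suc t)) (countFirst≥2-closed h g t) ⟩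
  (h C suc t) * X + (h C t) * X
    ≡⟨ *-distribʳ-+ X (h C suc t) (h C t) ⟨
  ((h C suc t) + (h C t)) * X
    ≡⟨ cong (_* X) (trans (+-comm (h C suc t) (h C t)) (nCk+nC[k+1]≡[n+1]C[k+1] h t)) ⟩
  (suc h C suc t) * X ∎
  where
  open ≡-Reasoning
  X : ℕ
  X = multichoose (suc t) g

countFirst≥2-closed h g t = begin
  ∑ (h + g + suc t) term
    ≡⟨ ∑-truncate 1+g≤m (λ {b} → countShiftedWeight-> (compositions (h + g + suc t ∸ suc b) h)) ⟩
  ∑ (suc g) term
    ≡⟨ ∑-cong (suc g) (λ b<1+g → term-closed (≤-pred b<1+g)) ⟩
  (∑[ b < suc g ] (h C t) * multichoose t (g ∸ b))
    ≡⟨ ∑-*ˡ (suc g) (h C t) (λ b → multichoose t (g ∸ b)) ⟩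
  (h C t) * (∑[ b < suc g ] multichoose t (g ∸ b))
    ≡⟨ cong ((h C t) *_) (multichoose-hockey t g) ⟩
  (h C t) * multichoose (suc t) g ∎
  where
  open ≡-Reasoning
  term : ℕ → ℕ
  term b = countShiftedWeight b g (compositions (h + g + suc t ∸ suc b) h)
  1+g≤m : suc g ≤ h + g + suc t
  1+g≤m = ≤-trans (m<m+n g z<s) (≤-trans (m≤n+m (g + suc t) h) (≤-reflexive (sym (+-assoc h g (suc t)))))
  shift : ∀ {b} → b ≤ g → h + g + suc t ∸ suc b ≡ h + (g ∸ b) + t
  shift {b} b≤g = begin
    h + g + suc t ∸ suc b
      ≡⟨ cong (λ x → h + x + suc t ∸ suc b) (m+[n∸m]≡n b≤g) ⟨
    h + (b + (g ∸ b)) + suc t ∸ suc b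
      ≡⟨ cong (_∸ suc b) (regroup h b (g ∸ b) t) ⟩
    suc b + (h + (g ∸ b) + t) ∸ suc b
      ≡⟨ m+n∸m≡n (suc b) _ ⟩
    h + (g ∸ b) + t ∎
    where
    regroup : ∀ h b r t → h + (b + r) + suc t ≡ suc b + (h + r + t)
    regroup = solve-∀
  term-closed : ∀ {b} → b ≤ g → term b ≡ (h C t) * multichoose t (g ∸ b)
  term-closed {b} b≤g = begin
    term b
      ≡⟨ countShiftedWeight-≤ (compositions (h + g + suc t ∸ suc b) h) b≤g ⟩
    countComp (h + g + suc t ∸ suc b) h (g ∸ b)
      ≡⟨ cong (λ n → countComp n h (g ∸ b)) (shift b≤g) ⟩
    countComp (h + (g ∸ b) + t) h (g ∸ b)
      ≡⟨ countComp-closed h (g ∸ b) t ⟩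
    (h C t) * multichoose t (g ∸ b) ∎

countComp-weight-zero : ∀ {m h} → h ≤ m → countComp m h 0 ≡ h C (m ∸ h)
countComp-weight-zero {m} {h} h≤m = begin
  countComp m h 0                   ≡⟨ cong (λ n → countComp n h 0) m≡h+0+[m∸h] ⟩
  countComp (h + 0 + (m ∸ h)) h 0   ≡⟨ countComp-closed h 0 (m ∸ h) ⟩
  (h C (m ∸ h)) * 1                 ≡⟨ *-identityʳ _ ⟩
  h C (m ∸ h)                       ∎
  where
  open ≡-Reasoning
  m≡h+0+[m∸h] : m ≡ h + 0 + (m ∸ h)
  m≡h+0+[m∸h] = sym (trans (cong (_+ (m ∸ h)) (+-identityʳ h)) (m+[n∸m]≡n h≤m))

countComp-weight-suc : ∀ m h g → countComp m h (suc g) ≡ cSum m h (suc g) / suc g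
countComp-weight-suc m h g with h + suc g ≤? m
... | no  h+g≰m = trans (countComp-vanishes h m (suc g) (≰⇒> h+g≰m))
                        (sym (cong (_/ suc g) (cSum-below m h (suc g) (≰⇒> h+g≰m))))
... | yes h+g≤m = subst (λ n → countComp n h (suc g) ≡ cSum n h (suc g) / suc g)
                        (m+[n∸m]≡n h+g≤m) (closed (m ∸ (h + suc g)))
  where
  open ≡-Reasoning
  closed : ∀ t → countComp (h + suc g + t) h (suc g) ≡ cSum (h + suc g + t) h (suc g) / suc g
  closed t = begin
    countComp (h + suc g + t) h (suc g)      ≡⟨ countComp-closed h (suc g) t ⟩
    (h C t) * X                              ≡⟨ m*n/n≡m ((h C t) * X) (suc g) ⟨
    (h C t) * X * suc g / suc g              ≡⟨ cong (_/ suc g) (begin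
      (h C t) * X * suc g                      ≡⟨ *-assoc (h C t) X (suc g) ⟩
      (h C t) * (X * suc g)                    ≡⟨ cong ((h C t) *_) (*-comm X (suc g)) ⟩
      (h C t) * (suc g * X)                    ≡⟨ cong ((h C t) *_) (weighted-vandermonde g t) ⟨
      (h C t) * (∑[ ℓ < suc t ] ℓ * (suc g C ℓ) * (t C ℓ)) ≡⟨ cSum-closed h (suc g) t ⟨
      cSum (h + suc g + t) h (suc g)           ∎) ⟩
    cSum (h + suc g + t) h (suc g) / suc g   ∎
    where
    X : ℕ
    X = multichoose t (suc g)

mainTheorem13 : (m h g : ℕ) → 1 ≤ h → h ≤ m →
    (countComp m h 0 ≡ h C (m ∸ h))
    × (countComp m h (suc g) ≡ cSum m h (suc g) / suc g)
mainTheorem13 m h g _ h≤m = countComp-weight-zero h≤m , countComp-weight-suc m h g
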